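{- Let $c,h\in\omega^\omega$ with $c>0$ and $h(i)\ge1$ for all but finitely many $i$. If $c',h'\in\omega^\omega$ with $c'>0$ satisfy, for all but finitely many $i<\omega$, $c'(i)\le|[c(i)]^{\le h(i)}\setminus\{\emptyset\}|$ and $h'(i)\ge|[c(i)-1]^{\le h(i)}\setminus\{\emptyset\}|$, then $\mathbf{Lc}(c',h')\preceq_T\mathbf{aLc}(c,h)$.
   Context: Natural numbers are identified with $\{0,\dots,n-1\}$. For $e,k\in\omega^\omega$: $\prod e=\prod_i e(i)$, $\mathcal{S}(e,k)=\prod_i[e(i)]^{\le k(i)}$; $x\in^*y$ iff $x(i)\in y(i)$ for almost all $i$; $x\notin^\infty y$ iff $x(i)\notin y(i)$ for almost all $i$. $\mathbf{Lc}(e,k):=\langle\prod e,\mathcal{S}(e,k),\in^*\rangle$ and $\mathbf{aLc}(e,k):=\langle\mathcal{S}(e,k),\prod e,R\rangle$ with $\varphi Ry$ iff $y\notin^\infty\varphi$. A Tukey connection from $\langle X,Y,\sqsubset\rangle$ to $\langle X',Y',\sqsubset'\rangle$ is $(F,G)$, $F:X\to X'$, $G:Y'\to Y$, with $F(x)\sqsubset'y'\Rightarrow x\sqsubset G(y')$; $\preceq_T$ denotes existence of one. -}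

module Defs where

open import Data.Nat using (ℕ; zero; suc; _≤_; _<_; _∸_; _≤?_)
open import Data.Fin using (Fin)
open import Data.Fin.Subset using (Subset; _∈_; _∉_; ∣_∣; inside; outside)
open import Data.List using (List; []; _∷_; _++_; map; filter; length)
open import Data.Vec using (_∷_; [])
open import Data.Product using (Σ; _×_; _,_)
open import Relation.Nullary.Decidable using (_×-dec_)

record RelSys : Set₁ where
  field
    X : Set
    Y : Set
    R : X → Y → Set

_≼T_ : RelSys → RelSys → Set
A ≼T B = Σ (RelSys.X A → RelSys.X B) λ F →
         Σ (RelSys.Y B → RelSys.Y A) λ G →
         ∀ x y → RelSys.R B (F x) y → RelSys.R A x (G y)

AlmostAll : (ℕ → Set) → Set
AlmostAll P = Σ ℕ λ N → ∀ i → N ≤ i → P i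

Prod : (ℕ → ℕ) → Set
Prod e = (i : ℕ) → Fin (e i)

Slalom : (ℕ → ℕ) → (ℕ → ℕ) → Set
Slalom e k = Σ ((i : ℕ) → Subset (e i)) λ φ → ∀ i → ∣ φ i ∣ ≤ k i

_∈*_ : ∀ {e k} → Prod e → Slalom e k → Set
_∈*_ x (φ , _) = AlmostAll λ i → x i ∈ φ i

_∉∞_ : ∀ {e k} → Prod e → Slalom e k → Set
_∉∞_ y (φ , _) = AlmostAll λ i → y i ∉ φ i

Lc : (ℕ → ℕ) → (ℕ → ℕ) → RelSys
Lc e k = record { X = Prod e ; Y = Slalom e k ; R = λ x φ → x ∈* φ }

aLc : (ℕ → ℕ) → (ℕ → ℕ) → RelSys
aLc e k = record { X = Slalom e k ; Y = Prod e ; R = λ φ y → y ∉∞ φ }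

allSubsets : (n : ℕ) → List (Subset n)
allSubsets zero = [] ∷ []
allSubsets (suc n) = map (inside ∷_) (allSubsets n) ++ map (outside ∷_) (allSubsets n)

nonemptyBounded : ℕ → ℕ → ℕ
nonemptyBounded n k =
  length (filter (λ s → (1 ≤? ∣ s ∣) ×-dec (∣ s ∣ ≤? k)) (allSubsets n))

module Submission where

-- Fix, for every i, an enumeration S i of the subsets of c(i) that
-- are nonempty and of size ≤ h(i).  Send x ∈ ∏ c' to the slalom whose i-th
-- entry is the x(i)-th set of S i; send y ∈ ∏ c to the slalom whose i-th
-- entry is the set of indices j < c'(i) whose set S i j avoids y(i).  If
-- y(i) ∉ S i (x i) for almost all i then x(i) lies in the second slalom for
-- almost all i.  The second slalom is legal because the number of sets in
-- S i avoiding a point of c(i) is exactly |[c(i)-1]^{≤h(i)} ∖ {∅}|.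

open import Defs
open import Data.Nat using (ℕ; _≤_; _<_; _∸_)
open import Data.Product using (_×_)

open import Level using (Level)
open import Function using (_∘_)
open import Data.Nat using (zero; suc; z≤n; s≤s; _≤?_; _⊔_)
open import Data.Nat.Properties using (≤-trans; ≤-reflexive; m≤m⊔n; m≤n⊔m)
open import Data.Bool using (Bool; true; false; if_then_else_)
open import Data.Empty using (⊥-elim)
open import Data.Fin using (Fin; toℕ) renaming (zero to fzero; suc to fsuc)
open import Data.Fin.Properties using (toℕ<n)
open import Data.Fin.Subset using (Subset; _∈_; _∉_; ∣_∣; inside; outside; ⊥)
open import Data.Fin.Subset.Properties using (_∈?_; ∣⊥∣≡0; drop-there)
open import Data.Vec using (_∷_; []; insertAt; here; there)
open import Data.List using (List; []; _∷_; _++_; map; filter; length)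
open import Data.List.Properties using (filter-++; filter-≐; filter-none; filter-all; map-++; map-∘; length-map)
open import Data.List.Relation.Unary.All as All using (All; []; _∷_; universal)
open import Data.List.Relation.Unary.All.Properties using (all-filter; map⁺)
open import Data.Product using (_,_; proj₁; proj₂)
open import Relation.Nullary using (Dec; yes; no; does; ¬?)
open import Relation.Nullary.Decidable using (_×-dec_)
open import Relation.Unary using (Pred; Decidable; _≐_)
open import Relation.Binary.PropositionalEquality using (_≡_; refl; sym; trans; cong; cong₂; subst; module ≡-Reasoning)

private
  variable
    a b p q : Level
    A : Set a
    B : Set b

filter-map : {P : Pred B p} (P? : Decidable P) (f : A → B) (xs : List A) →
             filter P? (map f xs) ≡ map f (filter (P? ∘ f) xs)
filter-map P? f [] = refl
filter-map P? f (x ∷ xs) with does (P? (f x))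
... | true  = cong (f x ∷_) (filter-map P? f xs)
... | false = filter-map P? f xs

filter-comm : {P : Pred A p} {Q : Pred A q} (P? : Decidable P) (Q? : Decidable Q)
              (xs : List A) → filter P? (filter Q? xs) ≡ filter Q? (filter P? xs)
filter-comm P? Q? [] = refl
filter-comm P? Q? (x ∷ xs) with does (P? x) in px | does (Q? x) in qx
... | true  | true  rewrite px | qx = cong (x ∷_) (filter-comm P? Q? xs)
... | true  | false rewrite qx      = filter-comm P? Q? xs
... | false | true  rewrite px      = filter-comm P? Q? xs
... | false | false                 = filter-comm P? Q? xs

nth : A → List A → ℕ → A
nth d []       k       = d
nth d (x ∷ xs) zero    = x
nth d (x ∷ xs) (suc k) = nth d xs k

nth-All : {P : Pred A p} {d : A} → P d → {xs : List A} → All P xs →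
          (k : ℕ) → P (nth d xs k)
nth-All pd []         k       = pd
nth-All pd (px ∷ pxs) zero    = px
nth-All pd (px ∷ pxs) (suc k) = nth-All pd pxs k

indicesWhere : {P : Pred A p} (n : ℕ) → Decidable P → List A → Subset n
indicesWhere n       P? []       = ⊥
indicesWhere zero    P? (x ∷ xs) = []
indicesWhere (suc n) P? (x ∷ xs) =
  (if does (P? x) then inside else outside) ∷ indicesWhere n P? xs

∣indicesWhere∣≤ : {P : Pred A p} (n : ℕ) (P? : Decidable P) (xs : List A) →
                  ∣ indicesWhere n P? xs ∣ ≤ length (filter P? xs)
∣indicesWhere∣≤ n       P? []       = ≤-reflexive (∣⊥∣≡0 n)
∣indicesWhere∣≤ zero    P? (x ∷ xs) = z≤n
∣indicesWhere∣≤ (suc n) P? (x ∷ xs) with does (P? x)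
... | true  = s≤s (∣indicesWhere∣≤ n P? xs)
... | false = ∣indicesWhere∣≤ n P? xs

indicesWhere-∈ : {P : Pred A p} {n : ℕ} (P? : Decidable P) (d : A) (xs : List A)
                 (j : Fin n) → toℕ j < length xs → P (nth d xs (toℕ j)) →
                 j ∈ indicesWhere n P? xs
indicesWhere-∈ P? d (x ∷ xs) fzero    _         px with P? x
... | yes _  = here
... | no ¬px = ⊥-elim (¬px px)
indicesWhere-∈ P? d (x ∷ xs) (fsuc j) (s≤s j<) pj = there (indicesWhere-∈ P? d xs j j< pj)

almostAll-map : {P Q : ℕ → Set} → (∀ {i} → P i → Q i) → AlmostAll P → AlmostAll Q
almostAll-map f (N , p) = N , λ i N≤i → f (p i N≤i)

almostAll-× : {P Q : ℕ → Set} → AlmostAll P → AlmostAll Q → AlmostAll (λ i → P i × Q i)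
almostAll-× (M , p) (N , q) =
  M ⊔ N , λ i M⊔N≤i → p i (≤-trans (m≤m⊔n M N) M⊔N≤i) , q i (≤-trans (m≤n⊔m M N) M⊔N≤i)

∣⊥∣≤ : (n k : ℕ) → ∣ ⊥ {n = n} ∣ ≤ k
∣⊥∣≤ n k = ≤-trans (≤-reflexive (∣⊥∣≡0 n)) z≤n

emptiedBefore : {e : ℕ → ℕ} (N : ℕ) (φ : (i : ℕ) → Subset (e i)) (i : ℕ) →
                Dec (N ≤ i) → Subset (e i)
emptiedBefore N φ i (yes _) = φ i
emptiedBefore N φ i (no  _) = ⊥

eventualSlalom : {e k : ℕ → ℕ} (φ : (i : ℕ) → Subset (e i)) →
                 AlmostAll (λ i → ∣ φ i ∣ ≤ k i) → Slalom e k
eventualSlalom {e} {k} φ (N , bounded) =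
  (λ i → emptiedBefore N φ i (N ≤? i)) , λ i → bound i (N ≤? i)
  where
  bound : (i : ℕ) (N≤?i : Dec (N ≤ i)) → ∣ emptiedBefore N φ i N≤?i ∣ ≤ k i
  bound i (yes N≤i) = bounded i N≤i
  bound i (no  _)   = ∣⊥∣≤ (e i) (k i)

eventualSlalom-agrees : {e k : ℕ → ℕ} (φ : (i : ℕ) → Subset (e i))
                        (bounded : AlmostAll (λ i → ∣ φ i ∣ ≤ k i)) →
                        AlmostAll (λ i → proj₁ (eventualSlalom φ bounded) i ≡ φ i)
eventualSlalom-agrees φ (N , _) = N , λ i N≤i → agree i N≤i (N ≤? i)
  where
  agree : (i : ℕ) → N ≤ i → (N≤?i : Dec (N ≤ i)) → emptiedBefore N φ i N≤?i ≡ φ i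
  agree i _   (yes _)   = refl
  agree i N≤i (no  N≰i) = ⊥-elim (N≰i N≤i)

_∉?_ : {n : ℕ} (y : Fin n) (s : Subset n) → Dec (y ∉ s)
y ∉? s = ¬? (y ∈? s)

enumeration-Tukey : {c h c' h' : ℕ → ℕ} (S : (i : ℕ) → List (Subset (c i))) →
                    ((i : ℕ) → All (λ s → ∣ s ∣ ≤ h i) (S i)) →
                    AlmostAll (λ i → c' i ≤ length (S i)
                                   × ((y : Fin (c i)) → length (filter (y ∉?_) (S i)) ≤ h' i)) →
                    Lc c' h' ≼T aLc c h
enumeration-Tukey {c} {h} {c'} {h'} S small long = F , G , tukey
  where
  F : Prod c' → Slalom c h
  F x = (λ i → nth ⊥ (S i) (toℕ (x i))) , λ i → nth-All (∣⊥∣≤ (c i) (h i)) (small i) (toℕ (x i))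

  avoiders : Prod c → (i : ℕ) → Subset (c' i)
  avoiders y i = indicesWhere (c' i) (y i ∉?_) (S i)

  few : (y : Prod c) → AlmostAll (λ i → ∣ avoiders y i ∣ ≤ h' i)
  few y = almostAll-map (λ {i} (_ , fewAvoid) →
            ≤-trans (∣indicesWhere∣≤ (c' i) (y i ∉?_) (S i)) (fewAvoid (y i))) long

  G : Prod c → Slalom c' h'
  G y = eventualSlalom (avoiders y) (few y)

  tukey : (x : Prod c') (y : Prod c) → y ∉∞ F x → x ∈* G y
  tukey x y missed =
    almostAll-map caught (almostAll-× long (almostAll-× (eventualSlalom-agrees _ (few y)) missed))
    where
    caught : ∀ {i} → (c' i ≤ length (S i) × ((z : Fin (c i)) → length (filter (z ∉?_) (S i)) ≤ h' i))
                     × (proj₁ (G y) i ≡ avoiders y i) × y i ∉ nth ⊥ (S i) (toℕ (x i)) →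
                     x i ∈ proj₁ (G y) i
    caught {i} ((enough , _) , agree , y∉) =
      subst (x i ∈_) (sym agree)
        (indicesWhere-∈ (y i ∉?_) ⊥ (S i) (x i) (≤-trans (toℕ<n (x i)) enough) y∉)

∣insertAt-outside∣ : {m : ℕ} (s : Subset m) (y : Fin (suc m)) →
                     ∣ insertAt s y outside ∣ ≡ ∣ s ∣
∣insertAt-outside∣ s              fzero    = refl
∣insertAt-outside∣ (inside  ∷ s) (fsuc y) = cong suc (∣insertAt-outside∣ s y)
∣insertAt-outside∣ (outside ∷ s) (fsuc y) = ∣insertAt-outside∣ s y

suc-∉≐ : {m : ℕ} (y : Fin m) (v : Bool) → (λ s → fsuc y ∉ v ∷ s) ≐ (y ∉_)
suc-∉≐ y v = (λ suc∉ y∈ → suc∉ (there y∈)) , (λ y∉ suc∈ → y∉ (drop-there suc∈))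

avoiding-subsets : {m : ℕ} (y : Fin (suc m)) →
                   filter (y ∉?_) (allSubsets (suc m)) ≡ map (λ s → insertAt s y outside) (allSubsets m)
avoiding-subsets {m} fzero = begin
  filter (fzero ∉?_) (map (inside ∷_) (allSubsets m) ++ map (outside ∷_) (allSubsets m))
    ≡⟨ filter-++ (fzero ∉?_) (map (inside ∷_) (allSubsets m)) _ ⟩
  filter (fzero ∉?_) (map (inside ∷_) (allSubsets m)) ++ filter (fzero ∉?_) (map (outside ∷_) (allSubsets m))
    ≡⟨ cong₂ _++_ (filter-none (fzero ∉?_) (map⁺ (universal (λ _ 0∉ → 0∉ here) (allSubsets m))))
                  (filter-all (fzero ∉?_) (map⁺ (universal (λ _ ()) (allSubsets m)))) ⟩
  map (outside ∷_) (allSubsets m)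
    ∎
  where open ≡-Reasoning
avoiding-subsets {suc m} (fsuc y) = begin
  filter (fsuc y ∉?_) (map (inside ∷_) (allSubsets (suc m)) ++ map (outside ∷_) (allSubsets (suc m)))
    ≡⟨ filter-++ (fsuc y ∉?_) (map (inside ∷_) (allSubsets (suc m))) _ ⟩
  filter (fsuc y ∉?_) (map (inside ∷_) (allSubsets (suc m))) ++ filter (fsuc y ∉?_) (map (outside ∷_) (allSubsets (suc m)))
    ≡⟨ cong₂ _++_ (underHead inside) (underHead outside) ⟩
  map insertY (map (inside ∷_) (allSubsets m)) ++ map insertY (map (outside ∷_) (allSubsets m))
    ≡⟨ sym (map-++ insertY (map (inside ∷_) (allSubsets m)) _) ⟩
  map insertY (map (inside ∷_) (allSubsets m) ++ map (outside ∷_) (allSubsets m))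
    ∎
  where
  open ≡-Reasoning
  insertY : Subset (suc m) → Subset (suc (suc m))
  insertY s = insertAt s (fsuc y) outside

  underHead : (v : Bool) → filter (fsuc y ∉?_) (map (v ∷_) (allSubsets (suc m)))
                      ≡ map insertY (map (v ∷_) (allSubsets m))
  underHead v = begin
    filter (fsuc y ∉?_) (map (v ∷_) (allSubsets (suc m)))
      ≡⟨ filter-map (fsuc y ∉?_) (v ∷_) (allSubsets (suc m)) ⟩
    map (v ∷_) (filter ((fsuc y ∉?_) ∘ (v ∷_)) (allSubsets (suc m)))
      ≡⟨ cong (map (v ∷_)) (filter-≐ _ (y ∉?_) (suc-∉≐ y v) (allSubsets (suc m))) ⟩
    map (v ∷_) (filter (y ∉?_) (allSubsets (suc m)))
      ≡⟨ cong (map (v ∷_)) (avoiding-subsets y) ⟩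
    map (v ∷_) (map (λ s → insertAt s y outside) (allSubsets m))
      ≡⟨ sym (map-∘ (allSubsets m)) ⟩
    map (λ s → v ∷ insertAt s y outside) (allSubsets m)
      ≡⟨ map-∘ (allSubsets m) ⟩
    map insertY (map (v ∷_) (allSubsets m))
      ∎

count-avoiding : {m : ℕ} {Q : Pred ℕ q} (Q? : Decidable Q) (y : Fin (suc m)) →
                 length (filter (Q? ∘ ∣_∣) (filter (y ∉?_) (allSubsets (suc m))))
                 ≡ length (filter (Q? ∘ ∣_∣) (allSubsets m))
count-avoiding {m = m} {Q = Q} Q? y = begin
  length (filter (Q? ∘ ∣_∣) (filter (y ∉?_) (allSubsets (suc m))))
    ≡⟨ cong (length ∘ filter (Q? ∘ ∣_∣)) (avoiding-subsets y) ⟩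
  length (filter (Q? ∘ ∣_∣) (map insertY (allSubsets m)))
    ≡⟨ cong length (filter-map (Q? ∘ ∣_∣) insertY (allSubsets m)) ⟩
  length (map insertY (filter (Q? ∘ ∣_∣ ∘ insertY) (allSubsets m)))
    ≡⟨ length-map insertY (filter (Q? ∘ ∣_∣ ∘ insertY) (allSubsets m)) ⟩
  length (filter (Q? ∘ ∣_∣ ∘ insertY) (allSubsets m))
    ≡⟨ cong length (filter-≐ _ (Q? ∘ ∣_∣) sizeKept (allSubsets m)) ⟩
  length (filter (Q? ∘ ∣_∣) (allSubsets m))
    ∎
  where
  open ≡-Reasoning
  insertY : Subset m → Subset (suc m)
  insertY s = insertAt s y outside

  sizeKept : (λ s → Q ∣ insertY s ∣) ≐ (λ s → Q ∣ s ∣)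
  sizeKept = (λ {s} → subst Q (∣insertAt-outside∣ s y)) , (λ {s} → subst Q (sym (∣insertAt-outside∣ s y)))

inRange? : (k : ℕ) → Decidable (λ j → 1 ≤ j × j ≤ k)
inRange? k j = (1 ≤? j) ×-dec (j ≤? k)

nonemptyBoundedList : (n k : ℕ) → List (Subset n)
nonemptyBoundedList n k = filter (inRange? k ∘ ∣_∣) (allSubsets n)

avoiding-nonemptyBounded : {n : ℕ} (k : ℕ) (y : Fin n) →
                           length (filter (y ∉?_) (nonemptyBoundedList n k)) ≡ nonemptyBounded (n ∸ 1) k
avoiding-nonemptyBounded {suc m} k y =
  trans (cong length (filter-comm (y ∉?_) (inRange? k ∘ ∣_∣) (allSubsets (suc m))))
        (count-avoiding (inRange? k) y)

lemma2p7 : (c h c' h' : ℕ → ℕ)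
    → (∀ i → 0 < c i)
    → AlmostAll (λ i → 1 ≤ h i)
    → (∀ i → 0 < c' i)
    → AlmostAll (λ i → c' i ≤ nonemptyBounded (c i) (h i)
                     × nonemptyBounded (c i ∸ 1) (h i) ≤ h' i)
    → Lc c' h' ≼T aLc c h
lemma2p7 c h c' h' _ _ _ sizes =
  enumeration-Tukey (λ i → nonemptyBoundedList (c i) (h i)) small (almostAll-map enough sizes)
  where
  small : (i : ℕ) → All (λ s → ∣ s ∣ ≤ h i) (nonemptyBoundedList (c i) (h i))
  small i = All.map proj₂ (all-filter _ (allSubsets (c i)))

  enough : ∀ {i} → c' i ≤ nonemptyBounded (c i) (h i) × nonemptyBounded (c i ∸ 1) (h i) ≤ h' i →
           c' i ≤ length (nonemptyBoundedList (c i) (h i))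
           × ((y : Fin (c i)) → length (filter (y ∉?_) (nonemptyBoundedList (c i) (h i))) ≤ h' i)
  enough {i} (c'≤ , ≤h') = c'≤ , λ y → ≤-trans (≤-reflexive (avoiding-nonemptyBounded (h i) y)) ≤h'
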